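{- Let a scale contain an odd number $m=2k+1$ of distinct notes, with $k\in\mathbb{N}$, $k\ge 1$. Call a $k$-element subset of the scale a $k$-chord and a $(k+1)$-element subset a $(k+1)$-chord. Then there are $\binom{m}{k}$ $k$-chords and $\binom{m}{k+1}=\binom{m}{k}$ $(k+1)$-chords; every $k$-chord is contained in exactly $k+1$ $(k+1)$-chords and every $(k+1)$-chord contains exactly $k+1$ $k$-chords. The inclusion relation thus gives a $(k+1)$-to-$(k+1)$ correspondence between the set of $k$-chords and the set of $(k+1)$-chords, and the associated bipartite incidence graph contains no cycles of length four. Hence, with $a=\binom{m}{k}$ and $b=k+1$, this incidence structure is a self-dual combinatorial configuration of type $\{a_b\}$.
   Context: A combinatorial configuration of type $\{a_b\}$ is an incidence structure of $a$ points and $a$ lines in which every point is incident with exactly $b$ lines, every line with exactly $b$ points, and any two distinct points are incident with at most one common line (equivalently, the bipartite incidence graph has no $4$-cycles). Here points are $k$-chords, lines are $(k+1)$-chords, and incidence is set inclusion. Self-dual means isomorphic to the structure obtained by interchanging points and lines. -}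

module Defs where

open import Data.Nat using (ℕ; suc; _+_; _*_)
open import Data.Fin using (Fin)
open import Data.Fin.Subset using (Subset; ∣_∣)
open import Data.Fin.Subset.Properties using (_⊆?_)
open import Data.Product using (Σ; proj₁)
open import Relation.Binary.PropositionalEquality using (_≡_; _≢_)
open import Relation.Nullary.Decidable using (True)
open import Function.Bundles using (_↔_; _⇔_; Inverse)

record IsConfiguration (P L : Set) (I : P → L → Set) (a b : ℕ) : Set where
  field
    pointCount : P ↔ Fin a
    lineCount  : L ↔ Fin a
    pointDeg   : (p : P) → Σ L (λ l → I p l) ↔ Fin b
    lineDeg    : (l : L) → Σ P (λ p → I p l) ↔ Fin b
    atMostOne  : (p q : P) (l l' : L) → p ≢ q →
                 I p l → I q l → I p l' → I q l' → l ≡ l'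

-- Self-duality: an isomorphism from (P, L, I) onto its dual (L, P, I ᵀ),
-- i.e. bijections α : P → L (points to dual points) and β : L → P
-- (lines to dual lines) preserving incidence in both directions.
SelfDual : (P L : Set) (I : P → L → Set) → Set
SelfDual P L I =
  Σ (P ↔ L) λ α → Σ (L ↔ P) λ β →
    (p : P) (l : L) → I p l ⇔ I (Inverse.to β l) (Inverse.to α p)

Chord : ℕ → ℕ → Set
Chord m j = Σ (Subset m) (λ s → ∣ s ∣ ≡ j)

-- Incidence = set inclusion (as the decision of _⊆_, so it is proof-irrelevant).
Incl : {m j j' : ℕ} → Chord m j → Chord m j' → Set
Incl c d = True (proj₁ c ⊆? proj₁ d)

-- Complementation in a scale of n = j + (j + 1) notes exchanges j-chords and
-- (j + 1)-chords and reverses inclusion, so the structure is self-dual and the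
-- point degree equals the line degree.  The j-subsets of a set of size s are
-- counted by s C j (Pascal's rule), so a (j + 1)-chord contains (j + 1) C j = j + 1
-- j-chords.  Two distinct j-chords lie in at most one (j + 1)-chord: their union.
module Submission where

open import Defs
open import Data.Bool.Properties using (T-irrelevant)
open import Data.Fin using (Fin; zero)
open import Data.Fin.Properties using (+↔⊎)
open import Data.Fin.Subset using (Subset; ∣_∣; _⊆_; _∪_; ∁; ⊤; inside; outside)
open import Data.Fin.Subset.Properties
  using (_⊆?_; drop-∷-⊆; out⊆; in⊆in; p⊆q⇒∣p∣≤∣q∣; p⊆p∪q; q⊆p∪q; x∈p∪q⁻; ⊆⊤; ∣⊤∣≡n;
         ∣∁p∣≡n∸∣p∣; p⊆q⇒∁p⊇∁q; ∁p⊆∁q⇒p⊇q; ∪-∩-booleanAlgebra)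
open import Data.Nat using (ℕ; zero; suc; _+_; _*_; _∸_; _≤_; _<_; _≤?_; s≤s⁻¹)
open import Data.Nat.Combinatorics
  using (_C_; nCk≡nC[n∸k]; nC1≡n; nCk+nC[k+1]≡[n+1]C[k+1])
open import Data.Nat.Properties
  using (≡-irrelevant; suc-injective; n≤1+n; m+n∸m≡n; m+n∸n≡m; +-comm; ≤⇒≯; ≰⇒>)
open import Data.Nat.Tactic.RingSolver using (solve-∀)
open import Data.Product using (Σ; _×_; _,_; proj₁)
open import Data.Sum using (_⊎_; inj₁; inj₂; [_,_])
open import Data.Sum.Function.Propositional using (_⊎-↔_)
open import Data.Vec.Base using ([]; _∷_; here)
open import Function using (_∘_; case_of_)
open import Function.Bundles using (_↔_; _⇔_; Inverse; Equivalence; mk↔ₛ′; mk⇔)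
open import Function.Construct.Composition using (_↔-∘_)
open import Function.Properties.Inverse using (↔-sym)
open import Function.Related.Propositional using (module EquationalReasoning)
import Algebra.Lattice.Properties.BooleanAlgebra as BooleanAlgebraProperties
open import Relation.Binary.PropositionalEquality
  using (_≡_; _≢_; refl; sym; trans; cong; subst; module ≡-Reasoning)
open import Relation.Nullary using (Irrelevant; contradiction)
open import Relation.Nullary.Decidable using (True; toWitness; fromWitness; decidable-stable)

private
  variable
    A : Set
    n j j′ : ℕ
    p q l : Subset n

Σ-≡-irrelevant : {B : A → Set} → (∀ {a} → Irrelevant (B a)) →
                 {x y : Σ A B} → proj₁ x ≡ proj₁ y → x ≡ y
Σ-≡-irrelevant B-irrelevant {a , b} {.a , b′} refl = cong (a ,_) (B-irrelevant b b′)

chord-≡ : {c d : Chord n j} → proj₁ c ≡ proj₁ d → c ≡ d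
chord-≡ = Σ-≡-irrelevant ≡-irrelevant

⊆-∣∣-antisym : p ⊆ q → ∣ q ∣ ≤ ∣ p ∣ → p ≡ q
⊆-∣∣-antisym {p = []}          {[]}          _   _   = refl
⊆-∣∣-antisym {p = outside ∷ p} {outside ∷ q} p⊆q q≤p =
  cong (outside ∷_) (⊆-∣∣-antisym (drop-∷-⊆ p⊆q) q≤p)
⊆-∣∣-antisym {p = inside ∷ p}  {inside ∷ q}  p⊆q q≤p =
  cong (inside ∷_) (⊆-∣∣-antisym (drop-∷-⊆ p⊆q) (s≤s⁻¹ q≤p))
⊆-∣∣-antisym {p = outside ∷ p} {inside ∷ q}  p⊆q q<p =
  contradiction q<p (≤⇒≯ (p⊆q⇒∣p∣≤∣q∣ (drop-∷-⊆ p⊆q)))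
⊆-∣∣-antisym {p = inside ∷ p}  {outside ∷ q} p⊆q _   = case p⊆q here of λ ()

-- If ∣ p ∪ q ∣ were at most j, then p ≡ p ∪ q ≡ q.
p≢q⇒p∪q≡l : p ≢ q → ∣ p ∣ ≡ j → ∣ q ∣ ≡ j → ∣ l ∣ ≡ suc j →
            p ⊆ l → q ⊆ l → p ∪ q ≡ l
p≢q⇒p∪q≡l {p = p} {q} {l = l} p≢q ∣p∣≡j ∣q∣≡j ∣l∣≡1+j p⊆l q⊆l =
  ⊆-∣∣-antisym p∪q⊆l ∣l∣≤∣p∪q∣
  where
  p∪q⊆l : p ∪ q ⊆ l
  p∪q⊆l x∈p∪q = [ p⊆l , q⊆l ] (x∈p∪q⁻ p q x∈p∪q)

  ∣l∣≤∣p∪q∣ : ∣ l ∣ ≤ ∣ p ∪ q ∣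
  ∣l∣≤∣p∪q∣ = decidable-stable (∣ l ∣ ≤? ∣ p ∪ q ∣) λ ∣l∣≰∣p∪q∣ →
    let ∣p∪q∣≤j = s≤s⁻¹ (subst (∣ p ∪ q ∣ <_) ∣l∣≡1+j (≰⇒> ∣l∣≰∣p∪q∣)) in
    p≢q (trans (≡p∪q ∣p∪q∣≤j (p⊆p∪q q) ∣p∣≡j) (sym (≡p∪q ∣p∪q∣≤j (q⊆p∪q p q) ∣q∣≡j)))
    where
    ≡p∪q : ∀ {r} → ∣ p ∪ q ∣ ≤ j → r ⊆ p ∪ q → ∣ r ∣ ≡ j → r ≡ p ∪ q
    ≡p∪q ∣p∪q∣≤j r⊆p∪q refl = ⊆-∣∣-antisym r⊆p∪q ∣p∪q∣≤j

chords-atMostOne : (p q : Chord n j) (l l′ : Chord n (suc j)) → p ≢ q →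
                   Incl p l → Incl q l → Incl p l′ → Incl q l′ → l ≡ l′
chords-atMostOne {j = j} (p , ∣p∣≡j) (q , ∣q∣≡j) (l , ∣l∣≡1+j) (l′ , ∣l′∣≡1+j)
                 p≢q p∈l q∈l p∈l′ q∈l′ =
  chord-≡ (trans (sym (p∪q≡ ∣l∣≡1+j p∈l q∈l)) (p∪q≡ ∣l′∣≡1+j p∈l′ q∈l′))
  where
  p∪q≡ : ∀ {r} → ∣ r ∣ ≡ suc j → True (p ⊆? r) → True (q ⊆? r) → p ∪ q ≡ r
  p∪q≡ {r} ∣r∣≡1+j p∈r q∈r = p≢q⇒p∪q≡l (p≢q ∘ chord-≡) ∣p∣≡j ∣q∣≡j ∣r∣≡1+j
    (toWitness {a? = p ⊆? r} p∈r) (toWitness {a? = q ⊆? r} q∈r)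

ChordIn : Subset n → ℕ → Set
ChordIn {n} l j = Σ (Chord n j) (λ c → True (proj₁ c ⊆? l))

chordIn-≡ : {c d : ChordIn l j} → proj₁ (proj₁ c) ≡ proj₁ (proj₁ d) → c ≡ d
chordIn-≡ = Σ-≡-irrelevant T-irrelevant ∘ chord-≡

-- True (x ∷ p ⊆? y ∷ q) is not definitionally True (p ⊆? q) (isYes is stuck at
-- different types), so evidence is transported through the witnesses.
⊆?-tail : ∀ {x y} → True (x ∷ p ⊆? y ∷ q) → True (p ⊆? q)
⊆?-tail {p = p} {q} {x} {y} h =
  fromWitness (λ {z} → drop-∷-⊆ (toWitness {a? = x ∷ p ⊆? y ∷ q} h) {z})

⊆?-outside : ∀ {y} → True (p ⊆? q) → True (outside ∷ p ⊆? y ∷ q)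
⊆?-outside {p = p} {q} h = fromWitness (λ {z} → out⊆ (toWitness {a? = p ⊆? q} h) {z})

⊆?-inside : True (p ⊆? q) → True (inside ∷ p ⊆? inside ∷ q)
⊆?-inside {p = p} {q} h = fromWitness (λ {z} → in⊆in (toWitness {a? = p ⊆? q} h) {z})

chordIn-[] : ∀ j → ChordIn [] j ↔ Fin (0 C j)
chordIn-[] zero    = mk↔ₛ′ (λ _ → zero) (λ _ → ([] , refl) , _)
                           (λ { zero → refl }) (λ { (([] , refl) , _) → refl })
chordIn-[] (suc j) = mk↔ₛ′ (λ { (([] , ()) , _) }) (λ ()) (λ ()) (λ { (([] , ()) , _) })

chordIn-outside : ChordIn (outside ∷ l) j ↔ ChordIn l j
chordIn-outside = mk↔ₛ′ tail (λ { ((s , e) , h) → ((outside ∷ s) , e) , ⊆?-outside h })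
                        (λ _ → chordIn-≡ refl) (λ { (((outside ∷ s) , e) , h) → chordIn-≡ refl })
  where
  tail : {l : Subset n} → ChordIn (outside ∷ l) j → ChordIn l j
  tail (((outside ∷ s) , e) , h) = (s , e) , ⊆?-tail h

chordIn-inside-zero : ChordIn (inside ∷ l) zero ↔ ChordIn l zero
chordIn-inside-zero = mk↔ₛ′ tail (λ { ((s , e) , h) → ((outside ∷ s) , e) , ⊆?-outside h })
                            (λ _ → chordIn-≡ refl) (λ { (((outside ∷ s) , e) , h) → chordIn-≡ refl })
  where
  tail : {l : Subset n} → ChordIn (inside ∷ l) zero → ChordIn l zero
  tail (((outside ∷ s) , e) , h) = (s , e) , ⊆?-tail h

chordIn-inside-suc : ChordIn (inside ∷ l) (suc j) ↔ (ChordIn l j ⊎ ChordIn l (suc j))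
chordIn-inside-suc = mk↔ₛ′ split join
  (λ { (inj₁ c) → cong inj₁ (chordIn-≡ refl) ; (inj₂ c) → cong inj₂ (chordIn-≡ refl) })
  (λ { (((inside ∷ s) , e) , h) → chordIn-≡ refl ; (((outside ∷ s) , e) , h) → chordIn-≡ refl })
  where
  split : {l : Subset n} → ChordIn (inside ∷ l) (suc j) → ChordIn l j ⊎ ChordIn l (suc j)
  split (((inside ∷ s) , e) , h)  = inj₁ ((s , suc-injective e) , ⊆?-tail h)
  split (((outside ∷ s) , e) , h) = inj₂ ((s , e) , ⊆?-tail h)
  join : {l : Subset n} → ChordIn l j ⊎ ChordIn l (suc j) → ChordIn (inside ∷ l) (suc j)
  join (inj₁ ((s , e) , h)) = ((inside ∷ s) , cong suc e) , ⊆?-inside h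
  join (inj₂ ((s , e) , h)) = ((outside ∷ s) , e) , ⊆?-outside h

chordIn↔Fin : (l : Subset n) (j : ℕ) → ChordIn l j ↔ Fin (∣ l ∣ C j)
chordIn↔Fin []            j       = chordIn-[] j
chordIn↔Fin (outside ∷ l) j       = chordIn↔Fin l j ↔-∘ chordIn-outside
chordIn↔Fin (inside ∷ l)  zero    = chordIn↔Fin l zero ↔-∘ chordIn-inside-zero
chordIn↔Fin (inside ∷ l)  (suc j) = begin
  ChordIn (inside ∷ l) (suc j)              ↔⟨ chordIn-inside-suc ⟩
  (ChordIn l j ⊎ ChordIn l (suc j))         ↔⟨ chordIn↔Fin l j ⊎-↔ chordIn↔Fin l (suc j) ⟩
  (Fin (∣ l ∣ C j) ⊎ Fin (∣ l ∣ C suc j))   ↔⟨ ↔-sym +↔⊎ ⟩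
  Fin (∣ l ∣ C j + ∣ l ∣ C suc j)           ≡⟨ cong Fin (nCk+nC[k+1]≡[n+1]C[k+1] ∣ l ∣ j) ⟩
  Fin (suc ∣ l ∣ C suc j)                   ∎
  where open EquationalReasoning

chord↔chordIn⊤ : Chord n j ↔ ChordIn ⊤ j
chord↔chordIn⊤ = mk↔ₛ′ (λ c → c , fromWitness (λ {x} → ⊆⊤ {x = x})) proj₁
                        (λ _ → chordIn-≡ refl) (λ _ → refl)

chord↔Fin : Chord n j ↔ Fin (n C j)
chord↔Fin {n} {j} = begin
  Chord n j           ↔⟨ chord↔chordIn⊤ ⟩
  ChordIn (⊤ {n}) j   ↔⟨ chordIn↔Fin ⊤ j ⟩
  Fin (∣ ⊤ {n} ∣ C j) ≡⟨ cong (λ s → Fin (s C j)) (∣⊤∣≡n n) ⟩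
  Fin (n C j)         ∎
  where open EquationalReasoning

[1+n]Cn≡1+n : ∀ n → suc n C n ≡ suc n
[1+n]Cn≡1+n n = begin
  suc n C n            ≡⟨ nCk≡nC[n∸k] (n≤1+n n) ⟩
  suc n C (suc n ∸ n)  ≡⟨ cong (suc n C_) (m+n∸n≡m 1 n) ⟩
  suc n C 1            ≡⟨ nC1≡n (suc n) ⟩
  suc n                ∎
  where open ≡-Reasoning

pointsOn↔Fin : (l : Chord n (suc j)) → Σ (Chord n j) (λ c → Incl c l) ↔ Fin (suc j)
pointsOn↔Fin {j = j} (l , ∣l∣≡1+j) = begin
  ChordIn l j          ↔⟨ chordIn↔Fin l j ⟩
  Fin (∣ l ∣ C j)      ≡⟨ cong (λ s → Fin (s C j)) ∣l∣≡1+j ⟩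
  Fin (suc j C j)      ≡⟨ cong Fin ([1+n]Cn≡1+n j) ⟩
  Fin (suc j)          ∎
  where open EquationalReasoning

∁-involutive : (p : Subset n) → ∁ (∁ p) ≡ p
∁-involutive {n} = BooleanAlgebraProperties.¬-involutive (∪-∩-booleanAlgebra n)

∣∁p∣≡j′ : {p : Subset n} → ∣ p ∣ ≡ j → j + j′ ≡ n → ∣ ∁ p ∣ ≡ j′
∣∁p∣≡j′ {n} {j′ = j′} {p} refl ∣p∣+j′≡n = begin
  ∣ ∁ p ∣            ≡⟨ ∣∁p∣≡n∸∣p∣ p ⟩
  n ∸ ∣ p ∣          ≡⟨ cong (_∸ ∣ p ∣) ∣p∣+j′≡n ⟨
  ∣ p ∣ + j′ ∸ ∣ p ∣  ≡⟨ m+n∸m≡n ∣ p ∣ j′ ⟩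
  j′                 ∎
  where open ≡-Reasoning

∁-chord : j + j′ ≡ n → Chord n j → Chord n j′
∁-chord j+j′≡n (s , ∣s∣≡j) = ∁ s , ∣∁p∣≡j′ {p = s} ∣s∣≡j j+j′≡n

∁-↔ : j + j′ ≡ n → Chord n j ↔ Chord n j′
∁-↔ {j} {j′} j+j′≡n = mk↔ₛ′ (∁-chord j+j′≡n) (∁-chord (trans (+-comm j′ j) j+j′≡n))
  (λ c → chord-≡ (∁-involutive (proj₁ c))) (λ c → chord-≡ (∁-involutive (proj₁ c)))

⊆?-∁ : True (p ⊆? q) ⇔ True (∁ q ⊆? ∁ p)
⊆?-∁ {p = p} {q} = mk⇔
  (λ p⊆q → fromWitness (λ {x} → p⊆q⇒∁p⊇∁q (toWitness {a? = p ⊆? q} p⊆q) {x}))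
  (λ ∁q⊆∁p → fromWitness (λ {x} → ∁p⊆∁q⇒p⊇q (toWitness {a? = ∁ q ⊆? ∁ p} ∁q⊆∁p) {x}))

chords-selfDual : j + j′ ≡ n → SelfDual (Chord n j) (Chord n j′) Incl
chords-selfDual {j} {j′} j+j′≡n = ∁-↔ j+j′≡n , ∁-↔ (trans (+-comm j′ j) j+j′≡n) , λ _ _ → ⊆?-∁

linesThrough↔pointsOn : {P L : Set} {I : P → L → Set} → (∀ {p l} → Irrelevant (I p l)) →
                        ((α , _) : SelfDual P L I) (p : P) →
                        Σ L (I p) ↔ Σ P (λ q → I q (Inverse.to α p))
linesThrough↔pointsOn {P} {L} {I} I-irrelevant (α , β , I⇔Iᵀ) p = mk↔ₛ′ to from to∘from from∘to
  where
  module β = Inverse β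
  p′ : L
  p′ = Inverse.to α p
  to : Σ L (I p) → Σ P (λ q → I q p′)
  to (l , p∈l) = β.to l , Equivalence.to (I⇔Iᵀ p l) p∈l
  from : Σ P (λ q → I q p′) → Σ L (I p)
  from (q , q∈p′) = β.from q , Equivalence.from (I⇔Iᵀ p (β.from q))
                                  (subst (λ r → I r p′) (sym (β.strictlyInverseˡ q)) q∈p′)
  to∘from : ∀ x → to (from x) ≡ x
  to∘from (q , _) = Σ-≡-irrelevant I-irrelevant (β.strictlyInverseˡ q)
  from∘to : ∀ x → from (to x) ≡ x
  from∘to (l , _) = Σ-≡-irrelevant I-irrelevant (β.strictlyInverseʳ l)

chords-isConfiguration : j + suc j ≡ n →
                         IsConfiguration (Chord n j) (Chord n (suc j)) Incl (n C j) (suc j)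
chords-isConfiguration {j = j} {n = n} j+1+j≡n = record
  { pointCount = chord↔Fin
  ; lineCount  = chord↔Fin ↔-∘ ∁-↔ (trans (+-comm (suc j) j) j+1+j≡n)
  ; pointDeg   = λ p → pointsOn↔Fin (∁-chord j+1+j≡n p) ↔-∘
                       linesThrough↔pointsOn T-irrelevant selfDual p
  ; lineDeg    = pointsOn↔Fin
  ; atMostOne  = chords-atMostOne
  }
  where
  selfDual : SelfDual (Chord n j) (Chord n (suc j)) Incl
  selfDual = chords-selfDual j+1+j≡n

k+[1+k]≡2*k+1 : ∀ k → k + suc k ≡ 2 * k + 1
k+[1+k]≡2*k+1 = solve-∀

proposition4 : (k : ℕ) → 1 ≤ k →
    IsConfiguration (Chord (2 * k + 1) k) (Chord (2 * k + 1) (suc k)) Incl ((2 * k + 1) C k) (suc k)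
    × SelfDual (Chord (2 * k + 1) k) (Chord (2 * k + 1) (suc k)) Incl
proposition4 k _ = chords-isConfiguration (k+[1+k]≡2*k+1 k) , chords-selfDual (k+[1+k]≡2*k+1 k)
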